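{- For every positive integer $n$, the graph $G_n$ constructed as described in the context has exactly $n$ vertices and is triangle-free, and there is an absolute constant $C > 0$ (independent of $n$ and of all choices made in the construction) such that $\alpha(G_n) \leq C n^{2/3}$ for all $n$; that is, $\alpha(G_n) = O(n^{2/3})$.
   Context: Construction of $G_n$ for a positive integer $n$: choose a positive integer $k$ with $n \leq k^3 + k^2 \leq 6n$, and a prime $p$ with $k \leq p \leq 2k$. Let $\mathcal{A}$ be the set of points and $\mathcal{B}$ the set of lines of the finite affine plane of order $p$ (it has $p^2$ points and $p^2+p$ lines, each line having $p$ points, any two distinct points on exactly one common line), so $\sum_{L \in \mathcal{B}} |L| = p^3 + p^2 \geq n$. For each line $L$ choose a subset $L' \subseteq L$ such that $\sum_{L \in \mathcal{B}} |L \setminus L'| = n$. Let $\mathcal{B}'$ consist of the truncated lines $L \setminus L'$ for those $L$ with $L \setminus L' \neq \emptyset$ (indexed by the line $L$), and let $\mathcal{A}'$ be the set of points lying in some member of $\mathcal{B}'$. Fix any strict linear order $<$ on $\mathcal{A}'$. Then $G_n$ has vertices all pairs $(x, L)$ with $x \in L \setminus L'$, and $(x, L_1)$, $(y, L_2)$ are adjacent iff $x < y$, $L_1 \neq L_2$, and $x \in L_2 \setminus L_2'$. $\alpha$ denotes the independence number. -}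

module Defs where

open import Data.Nat using (ℕ; zero; suc; _+_; _*_; _%_; _≡ᵇ_)
open import Data.Bool using (Bool; true; false; _∧_; not; T)
open import Data.Fin using (Fin; toℕ)
open import Data.List using (List; []; _∷_; map; length; filter; cartesianProduct; allFin; _++_)
open import Data.Nat.ListAction using (sum)
open import Data.List.Membership.Propositional using (_∈_)
open import Data.List.Relation.Unary.Unique.Propositional using (Unique)
open import Data.Product using (_×_; _,_; Σ; ∃)
open import Data.Sum using (_⊎_)
open import Data.Empty using (⊥)
open import Relation.Nullary using (¬_)
open import Relation.Nullary.Decidable using (does)
open import Relation.Binary.PropositionalEquality using (_≡_; _≢_)
open import Data.Bool.Properties using () renaming (_≟_ to _≟B_)

-- The affine plane AG(2,p) over ℤ/pℤ (p prime in the application).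
-- Points: pairs (x , y) ∈ Fin p × Fin p.
-- Lines:  y = m x + b  (mod p)  for m b ∈ Fin p, and vertical lines x = c.

Pt : ℕ → Set
Pt p = Fin p × Fin p

data Line (p : ℕ) : Set where
  slope : (m b : Fin p) → Line p
  vert  : (c : Fin p) → Line p

onLine : ∀ {p} → Line p → Pt p → Bool
onLine {zero}  _           (() , _)
onLine {suc q} (slope m b) (x , y) =
  ((toℕ m * toℕ x + toℕ b) % suc q) ≡ᵇ toℕ y
onLine {suc q} (vert c)    (x , y) = toℕ c ≡ᵇ toℕ x

allPts : (p : ℕ) → List (Pt p)
allPts p = cartesianProduct (allFin p) (allFin p)

allLines : (p : ℕ) → List (Line p)
allLines p = map (λ mb → slope (Data.Product.proj₁ mb) (Data.Product.proj₂ mb))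
                 (cartesianProduct (allFin p) (allFin p))
             ++ map vert (allFin p)

-- Truncation data: for each line L a subset L' of points (as a Boolean
-- predicate), required to satisfy L' ⊆ L.

Truncation : ℕ → Set
Truncation p = Line p → Pt p → Bool

IsTruncation : ∀ {p} → Truncation p → Set
IsTruncation {p} L' = ∀ (L : Line p) (x : Pt p) → T (L' L x) → T (onLine L x)

inRem : ∀ {p} → Truncation p → Line p → Pt p → Bool
inRem L' L x = onLine L x ∧ not (L' L x)

remSize : ∀ {p} → Truncation p → Line p → ℕ
remSize {p} L' L = length (filter (λ x → T? (inRem L' L x)) (allPts p))
  where
  T? : (b : Bool) → Relation.Nullary.Dec (T b)
  T? = Data.Bool.T?

totalRem : ∀ {p} → Truncation p → ℕ
totalRem {p} L' = sum (map (remSize L') (allLines p))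

InA' : ∀ {p} → Truncation p → Pt p → Set
InA' {p} L' x = ∃ λ (L : Line p) → T (inRem L' L x)

-- a strict linear order on 𝓐' (given as a relation on all points whose
-- strict-linear-order axioms are required on 𝓐'; only its restriction to
-- 𝓐' is ever used)
IsStrictLinearOrderOn : ∀ {p} → (Pt p → Set) → (Pt p → Pt p → Set) → Set
IsStrictLinearOrderOn {p} A _<_ =
  (∀ x → A x → ¬ (x < x)) ×
  (∀ x y z → A x → A y → A z → x < y → y < z → x < z) ×
  (∀ x y → A x → A y → x ≢ y → (x < y) ⊎ (y < x))

-- The graph G_n.  Vertices: pairs (x , L) with x ∈ L ∖ L'.

Vtx : ℕ → Set
Vtx p = Pt p × Line p

IsVertex : ∀ {p} → Truncation p → Vtx p → Set
IsVertex L' (x , L) = T (inRem L' L x)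

allVtx : (p : ℕ) → List (Vtx p)
allVtx p = cartesianProduct (allPts p) (allLines p)

numVertices : ∀ {p} → Truncation p → ℕ
numVertices {p} L' =
  length (filter (λ v → Data.Bool.T? (inRem L' (Data.Product.proj₂ v) (Data.Product.proj₁ v))) (allVtx p))

Arc : ∀ {p} → Truncation p → (Pt p → Pt p → Set) → Vtx p → Vtx p → Set
Arc L' _<_ (x , L₁) (y , L₂) = (x < y) × (L₁ ≢ L₂) × T (inRem L' L₂ x)

Adj : ∀ {p} → Truncation p → (Pt p → Pt p → Set) → Vtx p → Vtx p → Set
Adj L' _<_ u v = Arc L' _<_ u v ⊎ Arc L' _<_ v u

TriangleFree : ∀ {p} → Truncation p → (Pt p → Pt p → Set) → Set
TriangleFree {p} L' _<_ = ∀ (u v w : Vtx p) →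
  IsVertex L' u → IsVertex L' v → IsVertex L' w →
  Adj L' _<_ u v → Adj L' _<_ v w → Adj L' _<_ u w → ⊥

IsIndependent : ∀ {p} → Truncation p → (Pt p → Pt p → Set) → List (Vtx p) → Set
IsIndependent {p} L' _<_ S =
  Unique S × (∀ v → v ∈ S → IsVertex L' v) ×
  (∀ u v → u ∈ S → v ∈ S → ¬ Adj L' _<_ u v)

-- α(G_n) ≤ C · n^{2/3}, written without reals as  α^3 ≤ C^3 · n^2
-- (α unfolded: every independent set S has |S|^3 ≤ C^3 n^2)
IndepBound : ∀ {p} → Truncation p → (Pt p → Pt p → Set) → ℕ → ℕ → Set
IndepBound {p} L' _<_ C n =
  ∀ (S : List (Vtx p)) → IsIndependent L' _<_ S →
    length S Data.Nat.^ 3 Data.Nat.≤ C Data.Nat.^ 3 * n Data.Nat.^ 2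

-- Orient each edge of G_n from (x , L₁) to (y , L₂) when x < y; then x lies
-- on the truncated line L₂.  A cyclically oriented triangle contradicts the
-- order.  A transitive one, u → v → w with u → w, puts the distinct points of
-- u and v on both lines of v and w, and these lines differ: impossible in an
-- affine plane over a prime field.  In an independent set S, label (x , L) by
-- the point x if S has a later vertex (y , L) on the same line, and by L
-- otherwise.  Independence makes this labelling injective, so
-- α(G_n) ≤ p² + (p² + p) ≤ 12 k², and k³ ≤ 6 n then gives α(G_n)³ ≤ 40³ n².
module Submission where

open import Defs

open import Data.Bool using (Bool; true; false; T; T?; if_then_else_)
open import Data.Bool.Properties using (T-∧)
open import Data.Empty using (⊥)
open import Data.Fin using (Fin; toℕ)
import Data.Fin as Fin
open import Data.Fin.Properties using (toℕ-injective; toℕ<n)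
open import Data.List using (List; []; _∷_; map; length; filter; cartesianProduct; allFin; _++_)
open import Data.List.Membership.Propositional using (_∈_; find; lose)
open import Data.List.Membership.Propositional.Properties
  using (∈-∃++; ∈-++⁻; ∈-++⁺ˡ; ∈-++⁺ʳ; ∈-map⁺; ∈-cartesianProduct⁺; ∈-allFin)
open import Data.List.Properties
  using (length-++; length-++-sucʳ; length-map; length-tabulate; map-++; map-∘; map-cong)
open import Data.List.Relation.Binary.Subset.Propositional using (_⊆_)
import Data.List.Relation.Unary.All as All
import Data.List.Relation.Unary.All.Properties as Allₚ
open import Data.List.Relation.Unary.AllPairs using ([]; _∷_)
open import Data.List.Relation.Unary.Any using (Any; here; there; any?)
open import Data.List.Relation.Unary.Unique.Propositional using (Unique)
open import Data.Nat using (ℕ; zero; suc; _+_; _*_; _^_; _%_; _/_; _≤_; _<_; z≤n; s≤s; NonZero)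
open import Data.Nat.DivMod using (%-distribˡ-+; m≡m%n+[m/n]*n)
open import Data.Nat.Divisibility using (_∣_; ∣⇒≤; n∣m*n; ∣m+n∣m⇒∣n)
open import Data.Nat.ListAction using (sum)
open import Data.Nat.ListAction.Properties using (sum-++)
open import Data.Nat.Primality using (Prime; euclidsLemma)
open import Data.Nat.Properties
open import Algebra.Properties.CommutativeSemigroup +-commutativeSemigroup using (interchange)
open import Data.Nat.Solver using (module +-*-Solver)
open import Data.Nat.Tactic.RingSolver using (solve-∀)
open import Data.Product using (_×_; Σ; _,_; proj₁; proj₂)
open import Data.Product.Properties using (≡-dec)
open import Data.Sum using (_⊎_; inj₁; inj₂)
import Data.Sum as Sum
open import Function using (_∘_; id)
open import Function.Bundles using (Equivalence)
open import Relation.Binary.Definitions using (DecidableEquality)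
open import Relation.Binary.PropositionalEquality
open import Relation.Nullary using (Dec; yes; no; ¬_; contradiction)
import Relation.Nullary.Decidable as Dec

∣∧<⇒≡0 : ∀ {n a} → n ∣ a → a < n → a ≡ 0
∣∧<⇒≡0 {a = zero}  _   _   = refl
∣∧<⇒≡0 {a = suc _} n∣a a<n = contradiction (∣⇒≤ n∣a) (<⇒≱ a<n)

prime-∣-*-small : ∀ {n d e} → Prime n → n ∣ d * e → d < n → e < n → d ≡ 0 ⊎ e ≡ 0
prime-∣-*-small {d = d} {e} pr n∣de d<n e<n =
  Sum.map (λ n∣d → ∣∧<⇒≡0 n∣d d<n) (λ n∣e → ∣∧<⇒≡0 n∣e e<n) (euclidsLemma d e pr n∣de)

module _ (n : ℕ) .{{_ : NonZero n}} where

  %-cong-+ : ∀ {a a′ b b′} → a % n ≡ a′ % n → b % n ≡ b′ % n → (a + b) % n ≡ (a′ + b′) % n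
  %-cong-+ {a} {a′} {b} {b′} a≡a′ b≡b′ = begin
    (a + b) % n           ≡⟨ %-distribˡ-+ a b n ⟩
    (a % n + b % n) % n   ≡⟨ cong₂ (λ u v → (u + v) % n) a≡a′ b≡b′ ⟩
    (a′ % n + b′ % n) % n ≡⟨ %-distribˡ-+ a′ b′ n ⟨
    (a′ + b′) % n         ∎
    where open ≡-Reasoning

  +-%-absorbs⇒∣ : ∀ a b → (a + b) % n ≡ a % n → n ∣ b
  +-%-absorbs⇒∣ a b a+b≡a =
    ∣m+n∣m⇒∣n (subst (n ∣_) (sym quotients) (n∣m*n ((a + b) / n))) (n∣m*n (a / n))
    where
    open ≡-Reasoning
    quotients : a / n * n + b ≡ (a + b) / n * n
    quotients = +-cancelˡ-≡ (a % n) _ _ (begin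
      a % n + (a / n * n + b)       ≡⟨ +-assoc (a % n) (a / n * n) b ⟨
      a % n + a / n * n + b         ≡⟨ cong (_+ b) (m≡m%n+[m/n]*n a n) ⟨
      a + b                         ≡⟨ m≡m%n+[m/n]*n (a + b) n ⟩
      (a + b) % n + (a + b) / n * n ≡⟨ cong (_+ (a + b) / n * n) a+b≡a ⟩
      a % n + (a + b) / n * n       ∎)

  +-cancelˡ-%-ordered : ∀ c {b b′} → b′ ≤ b → b < n → (c + b) % n ≡ (c + b′) % n → b ≡ b′
  +-cancelˡ-%-ordered c {b′ = b′} b′≤b b<n c+b≡c+b′ with t , refl ← m≤n⇒∃[o]m+o≡n b′≤b =
    trans (cong (b′ +_) t≡0) (+-identityʳ b′)
    where
    t≡0 : t ≡ 0
    t≡0 = ∣∧<⇒≡0 (+-%-absorbs⇒∣ (c + b′) t (trans (cong (_% n) (+-assoc c b′ t)) c+b≡c+b′))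
                 (≤-<-trans (m≤n+m t b′) b<n)

  +-cancelˡ-% : ∀ c {b b′} → b < n → b′ < n → (c + b) % n ≡ (c + b′) % n → b ≡ b′
  +-cancelˡ-% c {b} {b′} b<n b′<n c+b≡c+b′ with ≤-total b′ b
  ... | inj₁ b′≤b = +-cancelˡ-%-ordered c b′≤b b<n c+b≡c+b′
  ... | inj₂ b≤b′ = sym (+-cancelˡ-%-ordered c b≤b′ b′<n (sym c+b≡c+b′))

  AgreeAt : (m b m′ b′ x : ℕ) → Set
  AgreeAt m b m′ b′ x = (m * x + b) % n ≡ (m′ * x + b′) % n

  agree-twice⇒∣ : ∀ m d b b′ x e →
    AgreeAt (m + d) b m b′ (x + e) → AgreeAt (m + d) b m b′ x → n ∣ d * e
  agree-twice⇒∣ m d b b′ x e agree₁ agree₂ = +-%-absorbs⇒∣ (B₁ + A₂) (d * e) (begin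
    (B₁ + A₂ + d * e) % n ≡⟨ cong (_% n) (cross-sum m d b b′ x e) ⟩
    (A₁ + B₂) % n         ≡⟨ %-cong-+ agree₁ (sym agree₂) ⟩
    (B₁ + A₂) % n         ∎)
    where
    open ≡-Reasoning
    A₁ B₁ A₂ B₂ : ℕ
    A₁ = (m + d) * (x + e) + b
    B₁ = m * (x + e) + b′
    A₂ = (m + d) * x + b
    B₂ = m * x + b′
    cross-sum : ∀ m d b b′ x e →
      m * (x + e) + b′ + ((m + d) * x + b) + d * e ≡ (m + d) * (x + e) + b + (m * x + b′)
    cross-sum = solve-∀

  slope-unique-ordered : Prime n → ∀ {m m′ b b′ x₁ x₂} →
    m′ ≤ m → x₂ ≤ x₁ → x₁ ≢ x₂ → m < n → x₁ < n →
    AgreeAt m b m′ b′ x₁ → AgreeAt m b m′ b′ x₂ → m ≡ m′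
  slope-unique-ordered pr {m′ = m′} {x₂ = x₂} m′≤m x₂≤x₁ x₁≢x₂ m<n x₁<n agree₁ agree₂
    with d , refl ← m≤n⇒∃[o]m+o≡n m′≤m | e , refl ← m≤n⇒∃[o]m+o≡n x₂≤x₁
    with prime-∣-*-small pr (agree-twice⇒∣ m′ d _ _ x₂ e agree₁ agree₂)
           (≤-<-trans (m≤n+m d m′) m<n) (≤-<-trans (m≤n+m e x₂) x₁<n)
  ... | inj₁ refl = +-identityʳ m′
  ... | inj₂ refl = contradiction (+-identityʳ x₂) x₁≢x₂

  slope-unique : Prime n → ∀ {m m′ b b′ x₁ x₂} →
    x₁ ≢ x₂ → m < n → m′ < n → x₁ < n → x₂ < n →
    AgreeAt m b m′ b′ x₁ → AgreeAt m b m′ b′ x₂ → m ≡ m′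
  slope-unique pr {m} {m′} {x₁ = x₁} {x₂} x₁≢x₂ m<n m′<n x₁<n x₂<n agree₁ agree₂
    with ≤-total m′ m | ≤-total x₂ x₁
  ... | inj₁ m′≤m | inj₁ x₂≤x₁ =
    slope-unique-ordered pr m′≤m x₂≤x₁ x₁≢x₂ m<n x₁<n agree₁ agree₂
  ... | inj₁ m′≤m | inj₂ x₁≤x₂ =
    slope-unique-ordered pr m′≤m x₁≤x₂ (≢-sym x₁≢x₂) m<n x₂<n agree₂ agree₁
  ... | inj₂ m≤m′ | inj₁ x₂≤x₁ =
    sym (slope-unique-ordered pr m≤m′ x₂≤x₁ x₁≢x₂ m′<n x₁<n (sym agree₁) (sym agree₂))
  ... | inj₂ m≤m′ | inj₂ x₁≤x₂ =
    sym (slope-unique-ordered pr m≤m′ x₁≤x₂ (≢-sym x₁≢x₂) m′<n x₂<n (sym agree₂) (sym agree₁))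

on-slope⇒≡ : ∀ {q} (m b : Fin (suc q)) {x y} → T (onLine (slope m b) (x , y)) →
  (toℕ m * toℕ x + toℕ b) % suc q ≡ toℕ y
on-slope⇒≡ _ _ = ≡ᵇ⇒≡ _ _

on-slope-ordinate-unique : ∀ {q} (m b : Fin (suc q)) {x y y′} →
  T (onLine (slope m b) (x , y)) → T (onLine (slope m b) (x , y′)) → (x , y) ≡ (x , y′)
on-slope-ordinate-unique m b {x} on on′ =
  cong (x ,_) (toℕ-injective (trans (sym (on-slope⇒≡ m b on)) (on-slope⇒≡ m b on′)))

on-vert⇒≡ : ∀ {q} (c : Fin (suc q)) (P : Pt (suc q)) → T (onLine (vert c) P) → c ≡ proj₁ P
on-vert⇒≡ _ _ on = toℕ-injective (≡ᵇ⇒≡ _ _ on)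

vert-slope-meet-once : ∀ {q} (c m b : Fin (suc q)) {P Q} →
  T (onLine (vert c) P) → T (onLine (vert c) Q) →
  T (onLine (slope m b) P) → T (onLine (slope m b) Q) → P ≡ Q
vert-slope-meet-once c m b {P} {Q} vert∋P vert∋Q slope∋P slope∋Q
  with refl ← trans (sym (on-vert⇒≡ c P vert∋P)) (on-vert⇒≡ c Q vert∋Q) =
  on-slope-ordinate-unique m b slope∋P slope∋Q

LinesMeetAtMostOnce : ℕ → Set
LinesMeetAtMostOnce p = ∀ {P Q : Pt p} {L M : Line p} → P ≢ Q →
  T (onLine L P) → T (onLine L Q) → T (onLine M P) → T (onLine M Q) → L ≡ M

affine-linesMeetAtMostOnce : ∀ {p} → Prime p → LinesMeetAtMostOnce p
affine-linesMeetAtMostOnce {suc q} pr {x₁ , _} {x₂ , _} {slope m b} {slope m′ b′} P≢Q L∋P L∋Q M∋P M∋Q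
  with x₁ Fin.≟ x₂
... | yes refl = contradiction (on-slope-ordinate-unique m b L∋P L∋Q) P≢Q
... | no x₁≢x₂ = cong₂ slope (toℕ-injective m≡m′) (toℕ-injective b≡b′)
  where
  agree : ∀ {x y} → T (onLine (slope m b) (x , y)) → T (onLine (slope m′ b′) (x , y)) →
    AgreeAt (suc q) (toℕ m) (toℕ b) (toℕ m′) (toℕ b′) (toℕ x)
  agree L∋ M∋ = trans (on-slope⇒≡ m b L∋) (sym (on-slope⇒≡ m′ b′ M∋))
  m≡m′ : toℕ m ≡ toℕ m′
  m≡m′ = slope-unique (suc q) pr (x₁≢x₂ ∘ toℕ-injective) (toℕ<n m) (toℕ<n m′) (toℕ<n x₁) (toℕ<n x₂)
           (agree L∋P M∋P) (agree L∋Q M∋Q)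
  b≡b′ : toℕ b ≡ toℕ b′
  b≡b′ = +-cancelˡ-% (suc q) (toℕ m * toℕ x₁) (toℕ<n b) (toℕ<n b′)
           (subst (λ k → AgreeAt (suc q) (toℕ m) (toℕ b) k (toℕ b′) (toℕ x₁))
                  (sym m≡m′) (agree L∋P M∋P))
affine-linesMeetAtMostOnce {suc q} pr {L = slope m b} {vert c} P≢Q L∋P L∋Q M∋P M∋Q =
  contradiction (vert-slope-meet-once c m b M∋P M∋Q L∋P L∋Q) P≢Q
affine-linesMeetAtMostOnce {suc q} pr {L = vert c} {slope m b} P≢Q L∋P L∋Q M∋P M∋Q =
  contradiction (vert-slope-meet-once c m b L∋P L∋Q M∋P M∋Q) P≢Q
affine-linesMeetAtMostOnce {suc q} pr {P} {L = vert c} {vert c′} P≢Q L∋P L∋Q M∋P M∋Q =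
  cong vert (trans (on-vert⇒≡ c P L∋P) (sym (on-vert⇒≡ c′ P M∋P)))

symmetrisation-triangle-free : ∀ {V : Set} (P : V → Set) (R : V → V → Set) →
  (∀ {a b c} → P a → P b → P c → R a b → R b c → R a c → ⊥) →
  (∀ {a b c} → P a → P b → P c → R a b → R b c → R c a → ⊥) →
  ∀ u v w → P u → P v → P w → R u v ⊎ R v u → R v w ⊎ R w v → R u w ⊎ R w u → ⊥
symmetrisation-triangle-free P R transitive cyclic u v w Pu Pv Pw = λ where
  (inj₁ uv) (inj₁ vw) (inj₁ uw) → transitive Pu Pv Pw uv vw uw
  (inj₁ uv) (inj₁ vw) (inj₂ wu) → cyclic Pu Pv Pw uv vw wu
  (inj₁ uv) (inj₂ wv) (inj₁ uw) → transitive Pu Pw Pv uw wv uv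
  (inj₁ uv) (inj₂ wv) (inj₂ wu) → transitive Pw Pu Pv wu uv wv
  (inj₂ vu) (inj₁ vw) (inj₁ uw) → transitive Pv Pu Pw vu uw vw
  (inj₂ vu) (inj₁ vw) (inj₂ wu) → transitive Pv Pw Pu vw wu vu
  (inj₂ vu) (inj₂ wv) (inj₁ uw) → cyclic Pu Pw Pv uw wv vu
  (inj₂ vu) (inj₂ wv) (inj₂ wu) → transitive Pw Pv Pu wv vu wu

length-filter-T? : ∀ {A : Set} (f : A → Bool) xs →
  length (filter (T? ∘ f) xs) ≡ sum (map (λ x → if f x then 1 else 0) xs)
length-filter-T? f []       = refl
length-filter-T? f (x ∷ xs) with f x
... | true  = cong suc (length-filter-T? f xs)
... | false = length-filter-T? f xs

sum-map-+ : ∀ {A : Set} (f g : A → ℕ) xs →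
  sum (map (λ x → f x + g x) xs) ≡ sum (map f xs) + sum (map g xs)
sum-map-+ f g []       = refl
sum-map-+ f g (x ∷ xs) =
  trans (cong (f x + g x +_) (sum-map-+ f g xs))
        (interchange (f x) (g x) (sum (map f xs)) (sum (map g xs)))

sum-map-0 : ∀ {A : Set} (xs : List A) → sum (map (λ _ → 0) xs) ≡ 0
sum-map-0 []       = refl
sum-map-0 (_ ∷ xs) = sum-map-0 xs

sum-cartesianProduct : ∀ {A B : Set} (f : A → B → ℕ) xs ys →
  sum (map (λ v → f (proj₁ v) (proj₂ v)) (cartesianProduct xs ys)) ≡
  sum (map (λ y → sum (map (λ x → f x y) xs)) ys)
sum-cartesianProduct f []       ys = sym (sum-map-0 ys)
sum-cartesianProduct {A} {B} f (x ∷ xs) ys = begin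
  sum (map f′ (map (x ,_) ys ++ cartesianProduct xs ys))         ≡⟨ cong sum (map-++ f′ (map (x ,_) ys) _) ⟩
  sum (map f′ (map (x ,_) ys) ++ map f′ (cartesianProduct xs ys)) ≡⟨ sum-++ (map f′ (map (x ,_) ys)) _ ⟩
  sum (map f′ (map (x ,_) ys)) + sum (map f′ (cartesianProduct xs ys))
    ≡⟨ cong₂ _+_ (sym (cong sum (map-∘ {g = f′} {f = x ,_} ys))) (sum-cartesianProduct f xs ys) ⟩
  sum (map (f x) ys) + sum (map (λ y → sum (map (λ x′ → f x′ y) xs)) ys)
    ≡⟨ sum-map-+ (f x) (λ y → sum (map (λ x′ → f x′ y) xs)) ys ⟨
  sum (map (λ y → sum (map (λ x′ → f x′ y) (x ∷ xs))) ys)          ∎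
  where
  open ≡-Reasoning
  f′ : A × B → ℕ
  f′ (x , y) = f x y

length-filter-cartesianProduct : ∀ {A B : Set} (g : A → B → Bool) xs ys →
  length (filter (λ v → T? (g (proj₁ v) (proj₂ v))) (cartesianProduct xs ys)) ≡
  sum (map (λ y → length (filter (λ x → T? (g x y)) xs)) ys)
length-filter-cartesianProduct g xs ys = begin
  length (filter (λ v → T? (g (proj₁ v) (proj₂ v))) (cartesianProduct xs ys))
    ≡⟨ length-filter-T? (λ v → g (proj₁ v) (proj₂ v)) (cartesianProduct xs ys) ⟩
  sum (map (λ v → if g (proj₁ v) (proj₂ v) then 1 else 0) (cartesianProduct xs ys))
    ≡⟨ sum-cartesianProduct (λ x y → if g x y then 1 else 0) xs ys ⟩
  sum (map (λ y → sum (map (λ x → if g x y then 1 else 0) xs)) ys)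
    ≡⟨ cong sum (map-cong (λ y → length-filter-T? (λ x → g x y) xs) ys) ⟨
  sum (map (λ y → length (filter (λ x → T? (g x y)) xs)) ys) ∎
  where open ≡-Reasoning

numVertices≡totalRem : ∀ {p} (L' : Truncation p) → numVertices L' ≡ totalRem L'
numVertices≡totalRem {p} L' =
  length-filter-cartesianProduct (λ x L → inRem L' L x) (allPts p) (allLines p)

module _ {A : Set} where

  Unique-⊆⇒length≤ : ∀ {xs ys : List A} → Unique xs → xs ⊆ ys → length xs ≤ length ys
  Unique-⊆⇒length≤ {[]}     _                  _     = z≤n
  Unique-⊆⇒length≤ {x ∷ xs} (x∉xs ∷ xs-unique) xs⊆ys
    with ys₁ , ys₂ , refl ← ∈-∃++ (xs⊆ys (here refl)) =
    begin
      suc (length xs)           ≤⟨ s≤s (Unique-⊆⇒length≤ xs-unique xs⊆ys₁++ys₂) ⟩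
      suc (length (ys₁ ++ ys₂)) ≡⟨ length-++-sucʳ ys₁ x ys₂ ⟨
      length (ys₁ ++ x ∷ ys₂)   ∎
    where
    open ≤-Reasoning
    remove : ∀ {z} → x ≢ z → z ∈ ys₁ ++ x ∷ ys₂ → z ∈ ys₁ ++ ys₂
    remove x≢z z∈ with ∈-++⁻ ys₁ z∈
    ... | inj₁ z∈ys₁        = ∈-++⁺ˡ z∈ys₁
    ... | inj₂ (here z≡x)   = contradiction (sym z≡x) x≢z
    ... | inj₂ (there z∈ys₂) = ∈-++⁺ʳ ys₁ z∈ys₂
    xs⊆ys₁++ys₂ : xs ⊆ ys₁ ++ ys₂
    xs⊆ys₁++ys₂ z∈xs = remove (All.lookup x∉xs z∈xs) (xs⊆ys (there z∈xs))

  Unique-map⁺-injectiveOn : ∀ {B : Set} {f : A → B} {xs} →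
    (∀ {a b} → a ∈ xs → b ∈ xs → f a ≡ f b → a ≡ b) → Unique xs → Unique (map f xs)
  Unique-map⁺-injectiveOn _ [] = []
  Unique-map⁺-injectiveOn injective (x∉xs ∷ xs-unique) =
    Allₚ.map⁺ (All.tabulate λ z∈xs fx≡fz →
      All.lookup x∉xs z∈xs (injective (here refl) (there z∈xs) fx≡fz))
    ∷ Unique-map⁺-injectiveOn (λ a∈ b∈ → injective (there a∈) (there b∈)) xs-unique

length-cartesianProduct : ∀ {A B : Set} (xs : List A) (ys : List B) →
  length (cartesianProduct xs ys) ≡ length xs * length ys
length-cartesianProduct []       ys = refl
length-cartesianProduct (x ∷ xs) ys = begin
  length (map (x ,_) ys ++ cartesianProduct xs ys)
    ≡⟨ length-++ (map (x ,_) ys) ⟩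
  length (map (x ,_) ys) + length (cartesianProduct xs ys)
    ≡⟨ cong₂ _+_ (length-map (x ,_) ys) (length-cartesianProduct xs ys) ⟩
  length ys + length xs * length ys ∎
  where open ≡-Reasoning

length-allFin : ∀ n → length (allFin n) ≡ n
length-allFin n = length-tabulate id

length-allPts : ∀ p → length (allPts p) ≡ p * p
length-allPts p =
  trans (length-cartesianProduct (allFin p) (allFin p)) (cong₂ _*_ (length-allFin p) (length-allFin p))

length-allLines : ∀ p → length (allLines p) ≡ p * p + p
length-allLines p = begin
  length (map _ (allPts p) ++ map vert (allFin p))
    ≡⟨ length-++ (map _ (allPts p)) ⟩
  length (map _ (allPts p)) + length (map vert (allFin p))
    ≡⟨ cong₂ _+_ (length-map _ (allPts p)) (length-map vert (allFin p)) ⟩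
  length (allPts p) + length (allFin p)
    ≡⟨ cong₂ _+_ (length-allPts p) (length-allFin p) ⟩
  p * p + p ∎
  where open ≡-Reasoning

∈-allPts : ∀ {p} (P : Pt p) → P ∈ allPts p
∈-allPts (x , y) = ∈-cartesianProduct⁺ (∈-allFin x) (∈-allFin y)

∈-allLines : ∀ {p} (L : Line p) → L ∈ allLines p
∈-allLines     (slope m b) = ∈-++⁺ˡ (∈-map⁺ (λ mb → slope (proj₁ mb) (proj₂ mb)) (∈-allPts (m , b)))
∈-allLines {p} (vert c)    = ∈-++⁺ʳ (map _ (allPts p)) (∈-map⁺ vert (∈-allFin c))

_≟-Pt_ : ∀ {p} → DecidableEquality (Pt p)
_≟-Pt_ = ≡-dec Fin._≟_ Fin._≟_

_≟-Line_ : ∀ {p} → DecidableEquality (Line p)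
slope m b ≟-Line slope m′ b′ =
  Dec.map′ (λ { (refl , refl) → refl }) (λ { refl → refl , refl }) ((m Fin.≟ m′) Dec.×-dec (b Fin.≟ b′))
slope _ _ ≟-Line vert _    = no λ ()
vert _    ≟-Line slope _ _ = no λ ()
vert c    ≟-Line vert c′   = Dec.map′ (cong vert) (λ { refl → refl }) (c Fin.≟ c′)

allPtsAndLines : (p : ℕ) → List (Pt p ⊎ Line p)
allPtsAndLines p = map inj₁ (allPts p) ++ map inj₂ (allLines p)

∈-allPtsAndLines : ∀ {p} (t : Pt p ⊎ Line p) → t ∈ allPtsAndLines p
∈-allPtsAndLines     (inj₁ P) = ∈-++⁺ˡ (∈-map⁺ inj₁ (∈-allPts P))
∈-allPtsAndLines {p} (inj₂ L) = ∈-++⁺ʳ (map inj₁ (allPts p)) (∈-map⁺ inj₂ (∈-allLines L))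

length-allPtsAndLines : ∀ p → length (allPtsAndLines p) ≡ p * p + (p * p + p)
length-allPtsAndLines p = begin
  length (map inj₁ (allPts p) ++ map inj₂ (allLines p))
    ≡⟨ length-++ (map inj₁ (allPts p)) ⟩
  length (map inj₁ (allPts p)) + length (map inj₂ (allLines p))
    ≡⟨ cong₂ _+_ (length-map inj₁ (allPts p)) (length-map inj₂ (allLines p)) ⟩
  length (allPts p) + length (allLines p)
    ≡⟨ cong₂ _+_ (length-allPts p) (length-allLines p) ⟩
  p * p + (p * p + p) ∎
  where open ≡-Reasoning

module Gₙ {p} (L' : Truncation p) (_≺_ : Pt p → Pt p → Set)
          (order : IsStrictLinearOrderOn (InA' L') _≺_) where

  private
    ≺-irrefl : ∀ x → InA' L' x → ¬ (x ≺ x)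
    ≺-irrefl = proj₁ order

    ≺-trans : ∀ x y z → InA' L' x → InA' L' y → InA' L' z → x ≺ y → y ≺ z → x ≺ z
    ≺-trans = proj₁ (proj₂ order)

    ≺-total : ∀ x y → InA' L' x → InA' L' y → x ≢ y → x ≺ y ⊎ y ≺ x
    ≺-total = proj₂ (proj₂ order)

  inRem⇒onLine : ∀ {L x} → T (inRem L' L x) → T (onLine L x)
  inRem⇒onLine = proj₁ ∘ Equivalence.to T-∧

  no-transitive-triangle : LinesMeetAtMostOnce p → ∀ {u v w} →
    IsVertex L' u → IsVertex L' v → IsVertex L' w →
    Arc L' _≺_ u v → Arc L' _≺_ v w → Arc L' _≺_ u w → ⊥
  no-transitive-triangle meet {x , L₁} {y , L₂} u∈ v∈ _ (x≺y , _ , x∈L₂) (_ , L₂≢L₃ , y∈L₃) (_ , _ , x∈L₃) =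
    L₂≢L₃ (meet x≢y (inRem⇒onLine x∈L₂) (inRem⇒onLine v∈) (inRem⇒onLine x∈L₃) (inRem⇒onLine y∈L₃))
    where
    x≢y : x ≢ y
    x≢y refl = ≺-irrefl x (L₁ , u∈) x≺y

  no-cyclic-triangle : ∀ {u v w} → IsVertex L' u → IsVertex L' v → IsVertex L' w →
    Arc L' _≺_ u v → Arc L' _≺_ v w → Arc L' _≺_ w u → ⊥
  no-cyclic-triangle {x , L₁} {y , L₂} {z , L₃} u∈ v∈ w∈ (x≺y , _) (y≺z , _) (z≺x , _) =
    ≺-irrefl x x∈ (≺-trans x z x x∈ z∈ x∈ (≺-trans x y z x∈ y∈ z∈ x≺y y≺z) z≺x)
    where
    x∈ : InA' L' x
    x∈ = L₁ , u∈
    y∈ : InA' L' y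
    y∈ = L₂ , v∈
    z∈ : InA' L' z
    z∈ = L₃ , w∈

  triangle-free : LinesMeetAtMostOnce p → TriangleFree L' _≺_
  triangle-free meet =
    symmetrisation-triangle-free (IsVertex L') (Arc L' _≺_) (no-transitive-triangle meet) no-cyclic-triangle

  ≺-dec : ∀ {x y} → InA' L' x → InA' L' y → Dec (x ≺ y)
  ≺-dec {x} {y} x∈ y∈ with x ≟-Pt y
  ... | yes refl = no (≺-irrefl x x∈)
  ... | no x≢y with ≺-total x y x∈ y∈ x≢y
  ...   | inj₁ x≺y = yes x≺y
  ...   | inj₂ y≺x = no λ x≺y → ≺-irrefl x x∈ (≺-trans x y x x∈ y∈ x∈ x≺y y≺x)

  LaterOnSameLine : Vtx p → Vtx p → Set
  LaterOnSameLine (x , L) (y , M) = IsVertex L' (x , L) × IsVertex L' (y , M) × M ≡ L × x ≺ y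

  laterOnSameLine? : ∀ v w → Dec (LaterOnSameLine v w)
  laterOnSameLine? (x , L) (y , M) with T? (inRem L' L x) | T? (inRem L' M y) | M ≟-Line L
  ... | no v∉   | _       | _     = no (v∉ ∘ proj₁)
  ... | yes _   | no w∉   | _     = no (w∉ ∘ proj₁ ∘ proj₂)
  ... | yes _   | yes _   | no M≢L = no (M≢L ∘ proj₁ ∘ proj₂ ∘ proj₂)
  ... | yes v∈ | yes w∈ | yes M≡L =
    Dec.map′ (λ x≺y → v∈ , w∈ , M≡L , x≺y) (proj₂ ∘ proj₂ ∘ proj₂) (≺-dec (L , v∈) (M , w∈))

  module _ (S : List (Vtx p)) where

    label : (v : Vtx p) → Dec (Any (LaterOnSameLine v) S) → Pt p ⊎ Line p
    label (x , _) (yes _) = inj₁ x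
    label (_ , L) (no _)  = inj₂ L

    label-injective : IsIndependent L' _≺_ S → ∀ {v v′} → v ∈ S → v′ ∈ S →
      (later : Dec (Any (LaterOnSameLine v) S)) (later′ : Dec (Any (LaterOnSameLine v′) S)) →
      label v later ≡ label v′ later′ → v ≡ v′
    label-injective (_ , _ , independent) {x , L} {.x , M} _ v′∈S (yes later) (yes _) refl
      with L ≟-Line M
    ... | yes L≡M = cong (x ,_) L≡M
    ... | no L≢M with find later
    ...   | (y , .L) , w∈S , (x∈L , _ , refl , x≺y) =
      contradiction (inj₁ (x≺y , L≢M ∘ sym , x∈L)) (independent (x , M) (y , L) v′∈S w∈S)
    label-injective (_ , vertices , _) {x , L} {x′ , .L} v∈S v′∈S (no none) (no none′) refl
      with x ≟-Pt x′
    ... | yes x≡x′ = cong (_, L) x≡x′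
    ... | no x≢x′ with ≺-total x x′ (L , vertices _ v∈S) (L , vertices _ v′∈S) x≢x′
    ...   | inj₁ x≺x′ = contradiction (lose v′∈S (vertices _ v∈S , vertices _ v′∈S , refl , x≺x′)) none
    ...   | inj₂ x′≺x = contradiction (lose v∈S (vertices _ v′∈S , vertices _ v∈S , refl , x′≺x)) none′
    label-injective _ _ _ (yes _) (no _)  ()
    label-injective _ _ _ (no _)  (yes _) ()

    independent-length≤ : IsIndependent L' _≺_ S → length S ≤ p * p + (p * p + p)
    independent-length≤ independent@(S-unique , _) = begin
      length S                   ≡⟨ length-map labelling S ⟨
      length (map labelling S)   ≤⟨ Unique-⊆⇒length≤ labels-unique (λ {t} _ → ∈-allPtsAndLines t) ⟩
      length (allPtsAndLines p)  ≡⟨ length-allPtsAndLines p ⟩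
      p * p + (p * p + p)        ∎
      where
      open ≤-Reasoning
      labelling : Vtx p → Pt p ⊎ Line p
      labelling v = label v (any? (laterOnSameLine? v) S)
      labels-unique : Unique (map labelling S)
      labels-unique =
        Unique-map⁺-injectiveOn (λ v∈S v′∈S → label-injective independent v∈S v′∈S _ _) S-unique

module _ where
  open +-*-Solver
  open ≤-Reasoning

  affine-plane-size≤ : ∀ {p k} → p ≤ 2 * k → p * p + (p * p + p) ≤ 12 * k ^ 2
  affine-plane-size≤ {p} {k} p≤2k = begin
    p * p + (p * p + p)     ≤⟨ +-monoʳ-≤ (p * p) (+-monoʳ-≤ (p * p) (n≤n*n p)) ⟩
    p * p + (p * p + p * p) ≡⟨ solve 1 (λ p → p :* p :+ (p :* p :+ p :* p) := con 3 :* p :^ 2) refl p ⟩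
    3 * p ^ 2               ≤⟨ *-monoʳ-≤ 3 (^-monoˡ-≤ 2 p≤2k) ⟩
    3 * (2 * k) ^ 2         ≡⟨ solve 1 (λ k → con 3 :* (con 2 :* k) :^ 2 := con 12 :* k :^ 2) refl k ⟩
    12 * k ^ 2              ∎
    where
    n≤n*n : ∀ n → n ≤ n * n
    n≤n*n zero        = z≤n
    n≤n*n n@(suc _) = m≤m*n n n

  cube≤ : ∀ {s k n} → s ≤ 12 * k ^ 2 → k ^ 3 ≤ 6 * n → s ^ 3 ≤ 40 ^ 3 * n ^ 2
  cube≤ {s} {k} {n} s≤12k² k³≤6n = begin
    s ^ 3              ≤⟨ ^-monoˡ-≤ 3 s≤12k² ⟩
    (12 * k ^ 2) ^ 3   ≡⟨ solve 1 (λ k → (con 12 :* k :^ 2) :^ 3 := con 1728 :* (k :^ 3) :^ 2) refl k ⟩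
    1728 * (k ^ 3) ^ 2 ≤⟨ *-monoʳ-≤ 1728 (^-monoˡ-≤ 2 k³≤6n) ⟩
    1728 * (6 * n) ^ 2 ≡⟨ solve 1 (λ n → con 1728 :* (con 6 :* n) :^ 2 := con 62208 :* n :^ 2) refl n ⟩
    62208 * n ^ 2      ≤⟨ *-monoˡ-≤ (n ^ 2) (≤ᵇ⇒≤ 62208 64000 _) ⟩
    40 ^ 3 * n ^ 2     ∎

theorem3p4 : Σ ℕ λ C → (1 ≤ C) ×
    (∀ (n k p : ℕ) → 1 ≤ n → 1 ≤ k →
      n ≤ k ^ 3 + k ^ 2 → k ^ 3 + k ^ 2 ≤ 6 * n →
      Prime p → k ≤ p → p ≤ 2 * k →
      (L' : Truncation p) → IsTruncation L' → totalRem L' ≡ n →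
      (_≺_ : Pt p → Pt p → Set) → IsStrictLinearOrderOn (InA' L') _≺_ →
      (numVertices L' ≡ n) × TriangleFree L' _≺_ ×
      IndepBound L' _≺_ C n)
-- Only p ≤ 2k and k³ ≤ 6n enter the estimates; the other hypotheses (and
-- L' ⊆ L) merely guarantee that the construction exists.
theorem3p4 = 40 , s≤s z≤n , λ n k p _ _ _ k³+k²≤6n p-prime _ p≤2k L' _ total≡n _≺_ order →
  let open Gₙ L' _≺_ order in
  trans (numVertices≡totalRem L') total≡n ,
  triangle-free (affine-linesMeetAtMostOnce p-prime) ,
  λ S independent → cube≤ {k = k} {n}
    (≤-trans (independent-length≤ S independent) (affine-plane-size≤ {k = k} p≤2k))
    (≤-trans (m≤m+n (k ^ 3) (k ^ 2)) k³+k²≤6n)
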